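{- For every integer $h\ge1$, let $t_{n,m,h}$ be the number of active growing binary trees of height $h$ with $n$ internal nodes and $m$ anchors, let $S_h=\{(n,k)\in\mathbb{Z}_{>0}^2 : t_{n,2k,h}\neq0\}$, and let $\Gamma_h=\{(n,k)\in S_h : t_{n+1,2k,h}=0\}$. Then \[ \Gamma_h=\{(2^{h-1}-1+i,\ i) : 1\le i\le 2^{h-1}\}. \] In particular all elements of $\Gamma_h$ lie on the line $n-k=2^{h-1}-1$.
   Context: Growing binary trees are plane (ordered) binary trees whose nodes are of three types: internal nodes, anchors (active leaves) and dead leaves. They are produced by the following growth process: at time $t=0$ the tree consists of a single anchor; at each time $t=1,2,\dots$, every anchor is simultaneously replaced either by a dead leaf or by an internal node with two anchors as children. A growing binary tree is any tree obtainable after finitely many steps of this process; it is active if it has at least one anchor. The height of a tree is the maximal distance from the root to a node. -}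

module Defs where

open import Data.Nat using (ℕ; zero; suc; _+_; _*_; _⊔_; _<_; _≤_)
open import Data.Product using (Σ; ∃; ∃-syntax; _×_)
open import Relation.Binary.PropositionalEquality using (_≡_)
open import Relation.Nullary using (¬_)

data Tree : Set where
  anchor : Tree
  dead   : Tree
  node   : Tree → Tree → Tree

data Step : Tree → Tree → Set where
  anchor→dead : Step anchor dead
  anchor→node : Step anchor (node anchor anchor)
  dead→dead   : Step dead dead
  node→node   : ∀ {l r l′ r′} → Step l l′ → Step r r′ → Step (node l r) (node l′ r′)

data Reach : ℕ → Tree → Set where
  start : Reach 0 anchor
  step  : ∀ {t T T′} → Reach t T → Step T T′ → Reach (suc t) T′

Growing : Tree → Set
Growing T = ∃[ t ] Reach t T

internals : Tree → ℕ
internals anchor     = 0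
internals dead       = 0
internals (node l r) = suc (internals l + internals r)

anchors : Tree → ℕ
anchors anchor     = 1
anchors dead       = 0
anchors (node l r) = anchors l + anchors r

Active : Tree → Set
Active T = 1 ≤ anchors T

height : Tree → ℕ
height anchor     = 0
height dead       = 0
height (node l r) = suc (height l ⊔ height r)

-- The set of active growing binary trees of height h with n internal nodes
-- and m anchors is nonempty, i.e. t_{n,m,h} ≠ 0.
t≢0 : ℕ → ℕ → ℕ → Set
t≢0 n m h = ∃[ T ] (Growing T × Active T × height T ≡ h × internals T ≡ n × anchors T ≡ m)

S : ℕ → ℕ → ℕ → Set
S h n k = 0 < n × 0 < k × t≢0 n (2 * k) h

Γ : ℕ → ℕ → ℕ → Set
Γ h n k = S h n k × ¬ t≢0 (suc n) (2 * k) h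

{-# OPTIONS --safe #-}
module Submission where

open import Defs
open import Data.Nat using (ℕ; zero; suc; _+_; _*_; _∸_; _^_; _≤_; z≤n; s≤s; s≤s⁻¹; _≤?_)
open import Data.Nat.Properties
open import Data.Nat.Tactic.RingSolver using (solve-∀)
open import Algebra.Properties.CommutativeSemigroup +-commutativeSemigroup using (interchange)
open import Data.Product using (∃-syntax; _×_; _,_)
open import Data.Sum using (_⊎_; inj₁; inj₂)
open import Data.Empty using (⊥-elim)
open import Function.Bundles using (_⇔_; mk⇔)
open import Relation.Nullary using (¬_; yes; no)
open import Relation.Binary.PropositionalEquality

-- The trees reachable in exactly t steps are those whose anchors all have
-- depth t and whose dead leaves have depth < t; such a tree, if active, has
-- height t. With d dead leaves and m anchors, Kraft's equality for the leaves
-- gives m + 2d ≤ 2^t, with equality iff every dead leaf has depth t − 1.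
-- Since n + 1 = m + d, this reads n + 1 ≤ 2^(h−1) + k when m = 2k and t = h.
-- If the inequality is strict, some dead leaf of depth < h − 1 can be replaced
-- by an internal node with two dead children, so (n, k) ∉ Γ_h. Conversely,
-- every 1 ≤ k ≤ 2^(h−1) is realised with equality, and then n + 1 internal
-- nodes are impossible.

data Grown : ℕ → Tree → Set where
  anchor : Grown 0 anchor
  dead   : ∀ {t} → Grown (suc t) dead
  node   : ∀ {t l r} → Grown t l → Grown t r → Grown (suc t) (node l r)

private
  variable
    t g n m k : ℕ
    T T′ : Tree

Grown-step : Grown t T → Step T T′ → Grown (suc t) T′
Grown-step anchor     anchor→dead       = dead
Grown-step anchor     anchor→node       = node anchor anchor
Grown-step dead       dead→dead         = dead
Grown-step (node l r) (node→node sl sr) = node (Grown-step l sl) (Grown-step r sr)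

Reach⇒Grown : Reach t T → Grown t T
Reach⇒Grown start      = anchor
Reach⇒Grown (step r s) = Grown-step (Reach⇒Grown r) s

Grown-unstep : Grown (suc t) T′ → ∃[ T ] (Grown t T × Step T T′)
Grown-unstep {zero}  dead                 = anchor , anchor , anchor→dead
Grown-unstep {zero}  (node anchor anchor) = anchor , anchor , anchor→node
Grown-unstep {suc t} dead                 = dead , dead , dead→dead
Grown-unstep {suc t} (node l r)
  with l₀ , gl , sl ← Grown-unstep l | r₀ , gr , sr ← Grown-unstep r
  = node l₀ r₀ , node gl gr , node→node sl sr

Grown⇒Reach : Grown t T → Reach t T
Grown⇒Reach anchor = start
Grown⇒Reach {suc t} G with T , G′ , s ← Grown-unstep G = step (Grown⇒Reach G′) s

height≤ : Grown t T → height T ≤ t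
height≤ anchor     = z≤n
height≤ dead       = z≤n
height≤ (node l r) = s≤s (⊔-lub (height≤ l) (height≤ r))

Active-node : ∀ l r → 1 ≤ anchors (node l r) → 1 ≤ anchors l ⊎ 1 ≤ anchors r
Active-node l r a with anchors l
... | zero  = inj₂ a
... | suc _ = inj₁ (s≤s z≤n)

≤height-active : Grown t T → Active T → t ≤ height T
≤height-active anchor _ = z≤n
≤height-active {T = node l r} (node gl gr) a with Active-node l r a
... | inj₁ al = s≤s (≤-trans (≤height-active gl al) (m≤m⊔n _ _))
... | inj₂ ar = s≤s (≤-trans (≤height-active gr ar) (m≤n⊔m _ _))

height-active : Grown t T → Active T → height T ≡ t
height-active G a = ≤-antisym (height≤ G) (≤height-active G a)

GrownWith : ℕ → ℕ → ℕ → Set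
GrownWith h n m = ∃[ T ] (Grown h T × internals T ≡ n × anchors T ≡ m)

t≢0⇒GrownWith : ∀ {h} → t≢0 n m h → 1 ≤ m × GrownWith h n m
t≢0⇒GrownWith (T , (t , R) , a , refl , n≡ , m≡) =
  subst (1 ≤_) m≡ a , T , subst (λ s → Grown s T) (sym (height-active G a)) G , n≡ , m≡
  where
  G : Grown t T
  G = Reach⇒Grown R

GrownWith⇒t≢0 : ∀ {h} → 1 ≤ m → GrownWith h n m → t≢0 n m h
GrownWith⇒t≢0 {h = h} 1≤m (T , G , n≡ , m≡) =
  T , (h , Grown⇒Reach G) , a , height-active G a , n≡ , m≡
  where
  a : Active T
  a = subst (1 ≤_) (sym m≡) 1≤m

deads : Tree → ℕ
deads anchor     = 0
deads dead       = 1
deads (node l r) = deads l + deads r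

-- For T in Grown t, kraft T bounds 2 ^ t times the Kraft sum Σ 2^(−depth) = 1
-- of its leaves from below, with equality iff all dead leaves have depth t ∸ 1.
kraft : Tree → ℕ
kraft T = anchors T + 2 * deads T

2*m≡m+m : ∀ m → 2 * m ≡ m + m
2*m≡m+m = solve-∀

kraft-node : ∀ l r → kraft (node l r) ≡ kraft l + kraft r
kraft-node l r = rearrange (anchors l) (anchors r) (deads l) (deads r)
  where
  rearrange : ∀ a b c d → (a + b) + 2 * (c + d) ≡ (a + 2 * c) + (b + 2 * d)
  rearrange = solve-∀

suc-internals≡leaves : ∀ T → suc (internals T) ≡ anchors T + deads T
suc-internals≡leaves anchor     = refl
suc-internals≡leaves dead       = refl
suc-internals≡leaves (node l r) = begin
  suc (suc (internals l + internals r))          ≡⟨ cong suc (+-suc (internals l) (internals r)) ⟨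
  suc (internals l) + suc (internals r)          ≡⟨ cong₂ _+_ (suc-internals≡leaves l) (suc-internals≡leaves r) ⟩
  (anchors l + deads l) + (anchors r + deads r)  ≡⟨ interchange (anchors l) (deads l) (anchors r) (deads r) ⟩
  (anchors l + anchors r) + (deads l + deads r)  ∎
  where open ≡-Reasoning

2*suc-internals≡kraft+anchors : ∀ T → 2 * suc (internals T) ≡ kraft T + anchors T
2*suc-internals≡kraft+anchors T = begin
  2 * suc (internals T)               ≡⟨ cong (2 *_) (suc-internals≡leaves T) ⟩
  2 * (anchors T + deads T)           ≡⟨ rearrange (anchors T) (deads T) ⟩
  anchors T + 2 * deads T + anchors T ∎
  where
  open ≡-Reasoning
  rearrange : ∀ a d → 2 * (a + d) ≡ a + 2 * d + a
  rearrange = solve-∀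

kraft≤2^ : Grown t T → kraft T ≤ 2 ^ t
kraft≤2^ anchor = ≤-refl
kraft≤2^ {suc t} dead = *-monoʳ-≤ 2 (m^n>0 2 t)
kraft≤2^ {suc t} {node l r} (node gl gr) = begin
  kraft (node l r)     ≡⟨ kraft-node l r ⟩
  kraft l + kraft r    ≤⟨ +-mono-≤ (kraft≤2^ gl) (kraft≤2^ gr) ⟩
  2 ^ t + 2 ^ t        ≡⟨ 2*m≡m+m (2 ^ t) ⟨
  2 ^ suc t            ∎
  where open ≤-Reasoning

anchors≤2^ : Grown t T → anchors T ≤ 2 ^ t
anchors≤2^ G = ≤-trans (m≤m+n _ _) (kraft≤2^ G)

Expansion : ℕ → Tree → Set
Expansion t T = ∃[ T′ ] (Grown t T′ × internals T′ ≡ suc (internals T) × anchors T′ ≡ anchors T)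

expand-or-kraft≡2^ : Grown t T → Expansion t T ⊎ kraft T ≡ 2 ^ t
expand-or-kraft≡2^ anchor   = inj₂ refl
expand-or-kraft≡2^ {1} dead = inj₂ refl
expand-or-kraft≡2^ {suc (suc t)} dead = inj₁ (node dead dead , node dead dead , refl , refl)
expand-or-kraft≡2^ {suc t} {node l r} (node gl gr)
  with expand-or-kraft≡2^ gl | expand-or-kraft≡2^ gr
... | inj₁ (l′ , gl′ , il , al) | _ =
  inj₁ (node l′ r , node gl′ gr , cong (λ x → suc (x + internals r)) il , cong (_+ anchors r) al)
... | inj₂ _ | inj₁ (r′ , gr′ , ir , ar) =
  inj₁ (node l r′ , node gl gr′ , cong suc (trans (cong (internals l +_) ir) (+-suc _ _)) , cong (anchors l +_) ar)
... | inj₂ kl | inj₂ kr =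
  inj₂ (trans (kraft-node l r) (trans (cong₂ _+_ kl kr) (sym (2*m≡m+m (2 ^ t)))))

split-≤+ : ∀ {a b} i → i ≤ a + b → ∃[ i₁ ] ∃[ i₂ ] (i₁ ≤ a × i₂ ≤ b × i₁ + i₂ ≡ i)
split-≤+ {a} i i≤a+b with i ≤? a
... | yes i≤a = i , 0 , i≤a , z≤n , +-identityʳ i
... | no  i≰a = a , i ∸ a , ≤-refl , m≤n+o⇒m∸n≤o i a i≤a+b , m+[n∸m]≡n (<⇒≤ (≰⇒> i≰a))

kraft-tight-tree : ∀ g {i} → i ≤ 2 ^ g →
  ∃[ T ] (Grown (suc g) T × anchors T ≡ 2 * i × kraft T ≡ 2 ^ suc g)
kraft-tight-tree zero {0} _ = dead , dead , refl , refl
kraft-tight-tree zero {1} _ = node anchor anchor , node anchor anchor , refl , refl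
kraft-tight-tree zero {suc (suc _)} (s≤s ())
kraft-tight-tree (suc g) {i} i≤
  with i₁ , i₂ , i₁≤ , i₂≤ , i₁+i₂≡i ← split-≤+ i (subst (i ≤_) (2*m≡m+m (2 ^ g)) i≤)
  with l , gl , al , kl ← kraft-tight-tree g i₁≤ | r , gr , ar , kr ← kraft-tight-tree g i₂≤
  = node l r , node gl gr , anchors≡ , kraft≡
  where
  open ≡-Reasoning
  anchors≡ : anchors l + anchors r ≡ 2 * i
  anchors≡ = begin
    anchors l + anchors r   ≡⟨ cong₂ _+_ al ar ⟩
    2 * i₁ + 2 * i₂         ≡⟨ *-distribˡ-+ 2 i₁ i₂ ⟨
    2 * (i₁ + i₂)           ≡⟨ cong (2 *_) i₁+i₂≡i ⟩
    2 * i                   ∎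
  kraft≡ : kraft (node l r) ≡ 2 ^ suc (suc g)
  kraft≡ = begin
    kraft (node l r)            ≡⟨ kraft-node l r ⟩
    kraft l + kraft r           ≡⟨ cong₂ _+_ kl kr ⟩
    2 ^ suc g + 2 ^ suc g       ≡⟨ 2*m≡m+m (2 ^ suc g) ⟨
    2 ^ suc (suc g)             ∎

suc-internals≤ : ∀ k → Grown (suc g) T → anchors T ≡ 2 * k → suc (internals T) ≤ 2 ^ g + k
suc-internals≤ {g} {T} k G a≡ = *-cancelˡ-≤ 2 (begin
  2 * suc (internals T)   ≡⟨ 2*suc-internals≡kraft+anchors T ⟩
  kraft T + anchors T     ≤⟨ +-mono-≤ (kraft≤2^ G) (≤-reflexive a≡) ⟩
  2 * 2 ^ g + 2 * k       ≡⟨ *-distribˡ-+ 2 (2 ^ g) k ⟨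
  2 * (2 ^ g + k)         ∎)
  where open ≤-Reasoning

kraft≡2^⇒suc-internals≡ : ∀ g k → kraft T ≡ 2 ^ suc g → anchors T ≡ 2 * k → suc (internals T) ≡ 2 ^ g + k
kraft≡2^⇒suc-internals≡ {T} g k tight a≡ = *-cancelˡ-≡ _ _ 2 (begin
  2 * suc (internals T)   ≡⟨ 2*suc-internals≡kraft+anchors T ⟩
  kraft T + anchors T     ≡⟨ cong₂ _+_ tight a≡ ⟩
  2 * 2 ^ g + 2 * k       ≡⟨ *-distribˡ-+ 2 (2 ^ g) k ⟨
  2 * (2 ^ g + k)         ∎)
  where open ≡-Reasoning

Γ⇒extremal : Γ (suc g) n k → suc n ≡ 2 ^ g + k × 1 ≤ k × k ≤ 2 ^ g
Γ⇒extremal {g} {n} {k} ((_ , 1≤k , T≢0) , maximal)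
  with 1≤2k , T , G , refl , a≡ ← t≢0⇒GrownWith T≢0
  with expand-or-kraft≡2^ G
... | inj₁ (T′ , G′ , i′ , a′) = ⊥-elim (maximal (GrownWith⇒t≢0 1≤2k (T′ , G′ , i′ , trans a′ a≡)))
... | inj₂ tight =
  kraft≡2^⇒suc-internals≡ g k tight a≡ , 1≤k , *-cancelˡ-≤ 2 (subst (_≤ 2 ^ suc g) a≡ (anchors≤2^ G))

extremal⇒Γ : suc n ≡ 2 ^ g + k → 1 ≤ k → k ≤ 2 ^ g → Γ (suc g) n k
extremal⇒Γ {n} {g} {k} suc-n≡ 1≤k k≤ with T , G , a≡ , tight ← kraft-tight-tree g k≤ =
  (s≤s⁻¹ (subst (2 ≤_) (sym suc-n≡) (+-mono-≤ (m^n>0 2 g) 1≤k)) , 1≤k ,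
   GrownWith⇒t≢0 1≤2k (T , G , internals≡ , a≡)) , maximal
  where
  1≤2k : 1 ≤ 2 * k
  1≤2k = ≤-trans 1≤k (m≤m+n k _)
  internals≡ : internals T ≡ n
  internals≡ = suc-injective (trans (kraft≡2^⇒suc-internals≡ g k tight a≡) (sym suc-n≡))
  maximal : ¬ t≢0 (suc n) (2 * k) (suc g)
  maximal T≢0 with _ , T′ , G′ , i′ , a′ ← t≢0⇒GrownWith T≢0 =
    <-irrefl suc-n≡ (subst (λ x → suc x ≤ 2 ^ g + k) i′ (suc-internals≤ k G′ a′))

suc[m∸1+k]≡m+k : ∀ {m} k → 1 ≤ m → suc (m ∸ 1 + k) ≡ m + k
suc[m∸1+k]≡m+k k (s≤s _) = refl

proposition4p2 : (h : ℕ) → 1 ≤ h → (n k : ℕ) →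
    Γ h n k ⇔ (∃[ i ] (1 ≤ i × i ≤ 2 ^ (h ∸ 1) × n ≡ 2 ^ (h ∸ 1) ∸ 1 + i × k ≡ i))
proposition4p2 (suc g) _ n k = mk⇔ to from
  where
  on-line : ∀ i → suc (2 ^ g ∸ 1 + i) ≡ 2 ^ g + i
  on-line i = suc[m∸1+k]≡m+k i (m^n>0 2 g)
  to : Γ (suc g) n k → ∃[ i ] (1 ≤ i × i ≤ 2 ^ g × n ≡ 2 ^ g ∸ 1 + i × k ≡ i)
  to γ with suc-n≡ , 1≤k , k≤ ← Γ⇒extremal γ =
    k , 1≤k , k≤ , suc-injective (trans suc-n≡ (sym (on-line k))) , refl
  from : ∃[ i ] (1 ≤ i × i ≤ 2 ^ g × n ≡ 2 ^ g ∸ 1 + i × k ≡ i) → Γ (suc g) n k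
  from (i , 1≤i , i≤ , refl , refl) = extremal⇒Γ (on-line i) 1≤i i≤
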